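{- Let $n\ge0$ be an integer and let $a_{r,s},b_{r,s},c_{r,s},d_{r,s}$ be the numbers defined recursively in the context. Then $a_{n,j}\in\mathbb{Q}$, $d_{n,k}\in\mathbb{Q}$, $b_{n,j}\in\sqrt3\cdot\mathbb{Q}$ and $c_{n,j}\in\sqrt3\cdot\mathbb{Q}$ for all integers $0\le j\le n-1$ and $0\le k\le n$ (whenever these numbers are defined).
   Context: Auxiliary polynomials. For $k\ge0$ define polynomials with rational coefficients recursively (sums over "$j>1$ odd" run over odd $j$ with $3\le j\le k+1$; sums over "$j$ even" over even $j$ with $0\le j\le k+1$; sums over "$j$ odd" over odd $j$ with $1\le j\le k+1$): $R_k(x)=\frac1{k+1}\sum_{j>1\text{ odd}}(-1)^{\frac{j+1}2}\binom{k+1}{j}3^{j-1}R_{k+1-j}(x)+\frac{1}{2(k+1)}\sum_{j\text{ even}}(-1)^{\frac j2}\binom{k+1}{j}(2^j+1)x^{k+1-j}$; $S_k(x)=\frac1{k+1}\sum_{j>1\text{ odd}}(-1)^{\frac{j+1}2}\binom{k+1}{j}3^{j-1}S_{k+1-j}(x)+\frac{1}{2(k+1)}\sum_{j\text{ odd}}(-1)^{\frac{j+1}2}\binom{k+1}{j}(2^j-1)x^{k+1-j}$; $P_k(x)=\frac1{k+1}\sum_{j>1\text{ odd}}(-1)^{\frac{j+1}2}\binom{k+1}{j}6^{j-1}P_{k+1-j}(x)+\frac{1}{2(k+1)}\sum_{j\text{ even}}(-1)^{\frac j2}\binom{k+1}{j}(5^j+1)x^{k+1-j}$; $Q_k(x)=\frac1{k+1}\sum_{j>1\text{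 odd}}(-1)^{\frac{j+1}2}\binom{k+1}{j}6^{j-1}Q_{k+1-j}(x)+\frac{1}{2(k+1)}\sum_{j\text{ odd}}(-1)^{\frac{j-1}2}\binom{k+1}{j}(5^j-1)x^{k+1-j}$; $Y_k(x)=\frac1{k+1}\sum_{j>1\text{ odd}}(-1)^{\frac{j+1}2}\binom{k+1}{j}3^{j-1}Y_{k+1-j}(x)-\frac{1}{k+1}\Big[x^{k+1}+\sum_{j\text{ even}}(-1)^{\frac j2}\binom{k+1}{j}3^jx^{k+1-j}\Big]$; $Z_k(x)=\frac1{k+1}\sum_{j>1\text{ odd}}(-1)^{\frac{j+1}2}\binom{k+1}{j}6^{j-1}Z_{k+1-j}(x)-\frac{2}{k+1}\sum_{j\text{ even}}(-1)^{\frac j2}\binom{k+1}{j}3^jx^{k+1-j}$. Coefficient notation: $R_{2m}(x)=\sum_{j=1}^{m+1}r_{2m,j}x^{2j-1}$, $R_{2m-1}(x)=\sum_{j=0}^{m}r_{2m-1,j}x^{2j}$, and analogously $p_{k,j},y_{k,j},z_{k,j}$ for $P_k,Y_k,Z_k$; $S_{2m-1}(x)=\sum_{j=1}^m s_{2m-1,j}x^{2j-1}$, $S_{2m}(x)=\sum_{j=0}^m s_{2m,j}x^{2j}$, and analogously $q_{k,j}$ for $Q_k$. Any coefficient with index outside these ranges is $0$. Recursive coefficients. Set $d_{0,0}=1$. For $n\ge0$, given $c_{n,0},\dots,c_{n,n-1}$ and $d_{n,0},\dots,d_{n,n}$, define for $1\le h\le n+1$ $a_{n+1,h-1}=\frac{1}{\sqrt3}\sum_{l=h}^n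 c_{n,l-1}(2^{2l-2h+1}s_{2l-1,h}+q_{2l-1,h})+\sum_{l=h-1}^n d_{n,l}(2^{2l-2h+2}r_{2l,h}+p_{2l,h})$, for $1\le h\le n$ $b_{n+1,h}=\sum_{l=h}^n c_{n,l-1}(2^{2l-2h}r_{2l-1,h}+p_{2l-1,h})+\frac1{\sqrt3}\sum_{l=h-1}^n d_{n,l}(2^{2l-2h+1}s_{2l,h}+q_{2l,h})$, and $b_{n+1,0}=\frac13\sum_{l=1}^n c_{n,l-1}\big(2^{2l}(2r_{2l-1,0}+y_{2l-1,0})+2p_{2l-1,0}+z_{2l-1,0}\big)+\frac2{\sqrt3}\sum_{l=0}^n d_{n,l}(2^{2l+1}s_{2l,0}+q_{2l,0})$. For $n\ge1$, given $a_{n,0},\dots,a_{n,n-1}$ and $b_{n,0},\dots,b_{n,n-1}$, define for $1\le h\le n$ $c_{n,h-1}=\frac1{\sqrt3}\sum_{l=h}^n a_{n,l-1}(2^{2l-2h+1}s_{2l-1,h}+q_{2l-1,h})+\sum_{l=h-1}^{n-1}b_{n,l}(2^{2l-2h+2}r_{2l,h}+p_{2l,h})$, $d_{n,0}=\frac13\sum_{l=1}^n a_{n,l-1}\big(2^{2l}(2r_{2l-1,0}+y_{2l-1,0})+2p_{2l-1,0}+z_{2l-1,0}\big)+\frac2{\sqrt3}\sum_{l=0}^{n-1}b_{n,l}(2^{2l+1}s_{2l,0}+q_{2l,0})$, and for $1\le h\le n$ $d_{n,h}=\sum_{l=h}^n a_{n,l-1}(2^{2l-2h}r_{2l-1,h}+p_{2l-1,h})+\frac1{\sqrt3}\sum_{l=h}^{n-1}b_{n,l}(2^{2l-2h+1}s_{2l,h}+q_{2l,h})$.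 Empty sums are $0$. Thus $a_{n,\cdot},b_{n,\cdot},c_{n,\cdot}$ are defined for $n\ge1$ with second index in $\{0,\dots,n-1\}$, and $d_{n,\cdot}$ for $n\ge0$ with second index in $\{0,\dots,n\}$. -}

module Defs where

open import Data.Nat as N using (ℕ; zero; suc; _∸_; ⌊_/2⌋; _≡ᵇ_)
open import Data.Nat.Properties using (m^n≢0)
open import Data.Nat.Combinatorics using (_C_)
open import Data.Bool using (Bool; true; false; if_then_else_)
open import Data.List using (List; []; _∷_)
open import Data.Integer using (+_)
import Data.Rational as Q
open Q using (ℚ; 0ℚ; 1ℚ)
open import Relation.Binary.PropositionalEquality using (_≡_)

⟦_⟧ : ℕ → ℚ
⟦ n ⟧ = + n Q./ 1

inv-suc : ℕ → ℚ
inv-suc m = + 1 Q./ suc m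

isEven : ℕ → Bool
isEven zero = true
isEven (suc zero) = false
isEven (suc (suc n)) = isEven n

sgn : ℕ → ℚ
sgn m = if isEven m then 1ℚ else Q.- 1ℚ

-- 2^e / 2^f, i.e. 2^(e-f) (the exponent e-f may be negative)
pw2 : ℕ → ℕ → ℚ
pw2 e f = (+ (2 N.^ e) Q./ (2 N.^ f)) {{m^n≢0 2 f}}

-- the integers lo, lo+1, ..., hi (empty if hi < lo)
range : ℕ → ℕ → List ℕ
range lo hi = go (suc hi ∸ lo) lo
  where
  go : ℕ → ℕ → List ℕ
  go zero    _ = []
  go (suc k) l = l ∷ go k (suc l)

-- Polynomials with rational coefficients, as coefficient functions
-- (P i = coefficient of x^i)

Poly : Set
Poly = ℕ → ℚ

0P : Poly
0P _ = 0ℚ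

_⊕_ : Poly → Poly → Poly
(f ⊕ g) i = f i Q.+ g i

_·P_ : ℚ → Poly → Poly
(a ·P f) i = a Q.* f i

X^ : ℕ → Poly
X^ d i = if d ≡ᵇ i then 1ℚ else 0ℚ

ΣP : List ℕ → (ℕ → Poly) → Poly
ΣP []       f = 0P
ΣP (j ∷ js) f = f j ⊕ ΣP js f

ΣPodd : List ℕ → (ℕ → Poly) → Poly
ΣPodd js f = ΣP js (λ j → if isEven j then 0P else f j)

ΣPeven : List ℕ → (ℕ → Poly) → Poly
ΣPeven js f = ΣP js (λ j → if isEven j then f j else 0P)

-- Implemented with fuel; F_k = go (k+1) k (the fuel always suffices,
-- as the recursive calls are at indices k+1-j ≤ k-2).
fam : ℕ → (ℕ → Poly) → ℕ → Poly
fam c g k = go (suc k) k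
  where
  go : ℕ → ℕ → Poly
  go zero    k = 0P
  go (suc f) k =
    (inv-suc k ·P ΣPodd (range 3 (suc k)) (λ j →
        (sgn ⌊ suc j /2⌋ Q.* ⟦ suc k C j ⟧ Q.* ⟦ c N.^ (j ∸ 1) ⟧) ·P go f (suc k ∸ j)))
    ⊕ g k

gR gS gP gQ gY gZ : ℕ → Poly
gR k = (+ 1 Q./ (2 N.* suc k)) ·P ΣPeven (range 0 (suc k)) (λ j →
         (sgn ⌊ j /2⌋ Q.* ⟦ suc k C j ⟧ Q.* ⟦ 2 N.^ j N.+ 1 ⟧) ·P X^ (suc k ∸ j))
gS k = (+ 1 Q./ (2 N.* suc k)) ·P ΣPodd (range 1 (suc k)) (λ j →
         (sgn ⌊ suc j /2⌋ Q.* ⟦ suc k C j ⟧ Q.* ⟦ 2 N.^ j ∸ 1 ⟧) ·P X^ (suc k ∸ j))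
gP k = (+ 1 Q./ (2 N.* suc k)) ·P ΣPeven (range 0 (suc k)) (λ j →
         (sgn ⌊ j /2⌋ Q.* ⟦ suc k C j ⟧ Q.* ⟦ 5 N.^ j N.+ 1 ⟧) ·P X^ (suc k ∸ j))
gQ k = (+ 1 Q./ (2 N.* suc k)) ·P ΣPodd (range 1 (suc k)) (λ j →
         (sgn ⌊ j ∸ 1 /2⌋ Q.* ⟦ suc k C j ⟧ Q.* ⟦ 5 N.^ j ∸ 1 ⟧) ·P X^ (suc k ∸ j))
gY k = (Q.- inv-suc k) ·P (X^ (suc k) ⊕ ΣPeven (range 0 (suc k)) (λ j →
         (sgn ⌊ j /2⌋ Q.* ⟦ suc k C j ⟧ Q.* ⟦ 3 N.^ j ⟧) ·P X^ (suc k ∸ j)))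
gZ k = (Q.- (⟦ 2 ⟧ Q.* inv-suc k)) ·P ΣPeven (range 0 (suc k)) (λ j →
         (sgn ⌊ j /2⌋ Q.* ⟦ suc k C j ⟧ Q.* ⟦ 3 N.^ j ⟧) ·P X^ (suc k ∸ j))

Rpol Spol Ppol Qpol Ypol Zpol : ℕ → Poly
Rpol = fam 3 gR
Spol = fam 3 gS
Ppol = fam 6 gP
Qpol = fam 6 gQ
Ypol = fam 3 gY
Zpol = fam 6 gZ

-- Coefficient extraction.
-- "R-type" (R, P, Y, Z): F_{2m}(x) = Σ_{j≥1} f_{2m,j} x^(2j-1),  F_{2m-1}(x) = Σ_{j≥0} f_{2m-1,j} x^(2j).
coefR : (ℕ → Poly) → ℕ → ℕ → ℚ
coefR F k zero    = if isEven k then 0ℚ else F k 0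
coefR F k (suc j) = if isEven k then F k (suc (2 N.* j)) else F k (2 N.* suc j)

-- "S-type" (S, Q): F_{2m-1}(x) = Σ_{j≥1} f_{2m-1,j} x^(2j-1),  F_{2m}(x) = Σ_{j≥0} f_{2m,j} x^(2j).
coefS : (ℕ → Poly) → ℕ → ℕ → ℚ
coefS F k zero    = if isEven k then F k 0 else 0ℚ
coefS F k (suc j) = if isEven k then F k (2 N.* suc j) else F k (suc (2 N.* j))

r s p q y z : ℕ → ℕ → ℚ
r = coefR Rpol
p = coefR Ppol
y = coefR Ypol
z = coefR Zpol
s = coefS Spol
q = coefS Qpol

record Q√3 : Set where
  constructor _+_√3
  field
    rat : ℚ
    irr : ℚ
open Q√3 public

0Q√3 : Q√3
0Q√3 = 0ℚ + 0ℚ √3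

_⊞_ : Q√3 → Q√3 → Q√3
(a + b √3) ⊞ (c + d √3) = (a Q.+ c) + (b Q.+ d) √3

_⊠_ : Q√3 → Q√3 → Q√3
(a + b √3) ⊠ (c + d √3) = (a Q.* c Q.+ ⟦ 3 ⟧ Q.* b Q.* d) + (a Q.* d Q.+ b Q.* c) √3

ι : ℚ → Q√3
ι a = a + 0ℚ √3

-- 1/√3 = (1/3)·√3
inv√3 : Q√3
inv√3 = 0ℚ + (+ 1 Q./ 3) √3

Σ[_⋯_] : ℕ → ℕ → (ℕ → Q√3) → Q√3
Σ[ lo ⋯ hi ] f = go (range lo hi)
  where
  go : List ℕ → Q√3
  go []       = 0Q√3
  go (l ∷ ls) = f l ⊞ go ls

InQ : Q√3 → Set
InQ x = irr x ≡ 0ℚ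

In√3Q : Q√3 → Set
In√3Q x = rat x ≡ 0ℚ

-- The recursive coefficients.  Families are stored as functions ℕ → Q√3;
-- only the arguments in the ranges stated in the paper are meaningful.

record CD : Set where
  field
    cc : ℕ → Q√3
    dd : ℕ → Q√3

record AB : Set where
  field
    aa : ℕ → Q√3
    bb : ℕ → Q√3

-- from (c_{n,·}, d_{n,·}) to (a_{n+1,·}, b_{n+1,·})
stepAB : ℕ → CD → AB
stepAB n x = record { aa = λ h' → aF (suc h') ; bb = bF }
  where
  open CD x
  aF : ℕ → Q√3     -- a_{n+1,h-1}
  aF h =
    (inv√3 ⊠ Σ[ h ⋯ n ] (λ l → cc (l ∸ 1) ⊠
        ι (pw2 (2 N.* l N.+ 1) (2 N.* h) Q.* s (2 N.* l ∸ 1) h Q.+ q (2 N.* l ∸ 1) h)))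
    ⊞ Σ[ h ∸ 1 ⋯ n ] (λ l → dd l ⊠
        ι (pw2 (2 N.* l N.+ 2) (2 N.* h) Q.* r (2 N.* l) h Q.+ p (2 N.* l) h))
  bF : ℕ → Q√3
  bF zero =
    (ι (+ 1 Q./ 3) ⊠ Σ[ 1 ⋯ n ] (λ l → cc (l ∸ 1) ⊠
        ι (⟦ 2 N.^ (2 N.* l) ⟧ Q.* (⟦ 2 ⟧ Q.* r (2 N.* l ∸ 1) 0 Q.+ y (2 N.* l ∸ 1) 0)
           Q.+ ⟦ 2 ⟧ Q.* p (2 N.* l ∸ 1) 0 Q.+ z (2 N.* l ∸ 1) 0)))
    ⊞ ((ι ⟦ 2 ⟧ ⊠ inv√3) ⊠ Σ[ 0 ⋯ n ] (λ l → dd l ⊠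
        ι (⟦ 2 N.^ (2 N.* l N.+ 1) ⟧ Q.* s (2 N.* l) 0 Q.+ q (2 N.* l) 0)))
  bF (suc h') = let h = suc h' in
    Σ[ h ⋯ n ] (λ l → cc (l ∸ 1) ⊠
        ι (pw2 (2 N.* l) (2 N.* h) Q.* r (2 N.* l ∸ 1) h Q.+ p (2 N.* l ∸ 1) h))
    ⊞ (inv√3 ⊠ Σ[ h ∸ 1 ⋯ n ] (λ l → dd l ⊠
        ι (pw2 (2 N.* l N.+ 1) (2 N.* h) Q.* s (2 N.* l) h Q.+ q (2 N.* l) h)))

-- from (a_{n,·}, b_{n,·}) to (c_{n,·}, d_{n,·})   (n ≥ 1)
stepCD : ℕ → AB → CD
stepCD n x = record { cc = λ h' → cF (suc h') ; dd = dF }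
  where
  open AB x
  cF : ℕ → Q√3     -- c_{n,h-1}
  cF h =
    (inv√3 ⊠ Σ[ h ⋯ n ] (λ l → aa (l ∸ 1) ⊠
        ι (pw2 (2 N.* l N.+ 1) (2 N.* h) Q.* s (2 N.* l ∸ 1) h Q.+ q (2 N.* l ∸ 1) h)))
    ⊞ Σ[ h ∸ 1 ⋯ n ∸ 1 ] (λ l → bb l ⊠
        ι (pw2 (2 N.* l N.+ 2) (2 N.* h) Q.* r (2 N.* l) h Q.+ p (2 N.* l) h))
  dF : ℕ → Q√3
  dF zero =
    (ι (+ 1 Q./ 3) ⊠ Σ[ 1 ⋯ n ] (λ l → aa (l ∸ 1) ⊠
        ι (⟦ 2 N.^ (2 N.* l) ⟧ Q.* (⟦ 2 ⟧ Q.* r (2 N.* l ∸ 1) 0 Q.+ y (2 N.* l ∸ 1) 0)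
           Q.+ ⟦ 2 ⟧ Q.* p (2 N.* l ∸ 1) 0 Q.+ z (2 N.* l ∸ 1) 0)))
    ⊞ ((ι ⟦ 2 ⟧ ⊠ inv√3) ⊠ Σ[ 0 ⋯ n ∸ 1 ] (λ l → bb l ⊠
        ι (⟦ 2 N.^ (2 N.* l N.+ 1) ⟧ Q.* s (2 N.* l) 0 Q.+ q (2 N.* l) 0)))
  dF (suc h') = let h = suc h' in
    Σ[ h ⋯ n ] (λ l → aa (l ∸ 1) ⊠
        ι (pw2 (2 N.* l) (2 N.* h) Q.* r (2 N.* l ∸ 1) h Q.+ p (2 N.* l ∸ 1) h))
    ⊞ (inv√3 ⊠ Σ[ h ⋯ n ∸ 1 ] (λ l → bb l ⊠
        ι (pw2 (2 N.* l N.+ 1) (2 N.* h) Q.* s (2 N.* l) h Q.+ q (2 N.* l) h)))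

cdSeq : ℕ → CD
cdSeq zero    = record { cc = λ _ → 0Q√3
                       ; dd = λ k → if k ≡ᵇ 0 then ι 1ℚ else 0Q√3 }
cdSeq (suc n) = stepCD (suc n) (stepAB n (cdSeq n))

-- (a_{n,·}, b_{n,·}) for n ≥ 1 (the value at n = 0 is never used)
abSeq : ℕ → AB
abSeq zero    = record { aa = λ _ → 0Q√3 ; bb = λ _ → 0Q√3 }
abSeq (suc n) = stepAB n (cdSeq n)

a b c d : ℕ → ℕ → Q√3
a n = AB.aa (abSeq n)
b n = AB.bb (abSeq n)
c n = CD.cc (cdSeq n)
d n = CD.dd (cdSeq n)

{-# OPTIONS --safe #-}
module Submission where

-- ℚ(√3) = ℚ ⊕ √3·ℚ is graded by ℤ/2: products add degrees, sums preserve
-- them.  All coefficients r, s, p, q, y, z of the auxiliary polynomials are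
-- rational, and in the recursion the factor 1/√3 (or 2/√3) stands exactly in
-- front of the sums whose degree has to flip.  Hence one step sends
-- (c irrational, d rational) to (a rational, b irrational) and the next step
-- sends it back; induction on n from d₀,₀ = 1.

open import Defs
open import Data.Nat as ℕ using (ℕ; zero; suc; _∸_; _≤_; _<_; _≤?_; s≤s)
open import Data.Nat.Properties using (m≤n⇒m∸n≡0; +-∸-assoc; ≰⇒>; ≤-refl)
open import Data.Parity.Base using (Parity; 0ℙ; 1ℙ; _⁻¹) renaming (_+_ to _+ℙ_)
import Data.Parity.Properties as ℙ
open import Data.Integer using (+_)
open import Function using (id)
open import Data.Product using (_×_; _,_)
open import Data.Rational as ℚ using (ℚ; 0ℚ)
open import Data.Rational.Properties using (*-zeroˡ; *-zeroʳ; +-identityˡ)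
open import Relation.Nullary using (yes; no)
open import Relation.Binary.PropositionalEquality using (_≡_; refl; sym; subst)

component : Parity → Q√3 → ℚ
component 0ℙ = rat
component 1ℙ = irr

-- A record rather than a function of the parity, so that Agda can infer the
-- parity and the element from it.
record Homogeneous (p : Parity) (x : Q√3) : Set where
  constructor homogeneous
  field other-component≡0 : component (p ⁻¹) x ≡ 0ℚ

open Homogeneous

HomogeneousFamily : Parity → (ℕ → Q√3) → Set
HomogeneousFamily p u = ∀ k → Homogeneous p (u k)

0Q√3-homogeneous : ∀ p → Homogeneous p 0Q√3
0Q√3-homogeneous 0ℙ = homogeneous refl
0Q√3-homogeneous 1ℙ = homogeneous refl

ι-homogeneous : ∀ w → Homogeneous 0ℙ (ι w)
ι-homogeneous _ = homogeneous refl

inv√3-homogeneous : Homogeneous 1ℙ inv√3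
inv√3-homogeneous = homogeneous refl

⊞-homogeneous : ∀ {p x y} → Homogeneous p x → Homogeneous p y → Homogeneous p (x ⊞ y)
⊞-homogeneous {0ℙ} {_ + _ √3} {_ + _ √3} (homogeneous refl) (homogeneous refl) =
  homogeneous (+-identityˡ 0ℚ)
⊞-homogeneous {1ℙ} {_ + _ √3} {_ + _ √3} (homogeneous refl) (homogeneous refl) =
  homogeneous (+-identityˡ 0ℚ)

⊠-homogeneous : ∀ {p q x y} → Homogeneous p x → Homogeneous q y →
                Homogeneous (p +ℙ q) (x ⊠ y)
⊠-homogeneous {0ℙ} {0ℙ} {a + _ √3} {c + _ √3} (homogeneous refl) (homogeneous refl)
  rewrite *-zeroʳ a | *-zeroˡ c = homogeneous (+-identityˡ 0ℚ)
⊠-homogeneous {0ℙ} {1ℙ} {a + _ √3} {_ + d √3} (homogeneous refl) (homogeneous refl)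
  rewrite *-zeroʳ a | *-zeroʳ ⟦ 3 ⟧ | *-zeroˡ d = homogeneous (+-identityˡ 0ℚ)
⊠-homogeneous {1ℙ} {0ℙ} {_ + b √3} {c + _ √3} (homogeneous refl) (homogeneous refl)
  rewrite *-zeroˡ c | *-zeroʳ (⟦ 3 ⟧ ℚ.* b) = homogeneous (+-identityˡ 0ℚ)
⊠-homogeneous {1ℙ} {1ℙ} {_ + b √3} {_ + d √3} (homogeneous refl) (homogeneous refl)
  rewrite *-zeroˡ d | *-zeroʳ b = homogeneous (+-identityˡ 0ℚ)

Σ-cons : ∀ {lo hi} (f : ℕ → Q√3) → lo ≤ hi → Σ[ lo ⋯ hi ] f ≡ f lo ⊞ Σ[ suc lo ⋯ hi ] f
Σ-cons f lo≤hi rewrite +-∸-assoc 1 lo≤hi = refl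

Σ-empty : ∀ {lo hi} (f : ℕ → Q√3) → hi < lo → Σ[ lo ⋯ hi ] f ≡ 0Q√3
Σ-empty f hi<lo rewrite m≤n⇒m∸n≡0 hi<lo = refl

Σ-homogeneous : ∀ {p} {f : ℕ → Q√3} → HomogeneousFamily p f →
                ∀ lo hi → Homogeneous p (Σ[ lo ⋯ hi ] f)
Σ-homogeneous {p} {f} hf lo hi = bounded (suc hi ∸ lo) lo ≤-refl
  where
  bounded : ∀ fuel lo → suc hi ∸ lo ≤ fuel → Homogeneous p (Σ[ lo ⋯ hi ] f)
  bounded fuel lo bound with lo ≤? hi
  ... | no lo≰hi = subst (Homogeneous p) (sym (Σ-empty f (≰⇒> lo≰hi))) (0Q√3-homogeneous p)
  ... | yes lo≤hi with subst (_≤ fuel) (+-∸-assoc 1 lo≤hi) bound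
  ...   | s≤s bound′ = subst (Homogeneous p) (sym (Σ-cons f lo≤hi))
                         (⊞-homogeneous (hf lo) (bounded _ (suc lo) bound′))

Σ-scaled-homogeneous : ∀ {p u} → HomogeneousFamily p u →
  ∀ lo hi (k : ℕ → ℕ) (w : ℕ → ℚ) → Homogeneous p (Σ[ lo ⋯ hi ] λ l → u (k l) ⊠ ι (w l))
Σ-scaled-homogeneous {p} {u} hu lo hi k w = Σ-homogeneous scaled lo hi
  where
  scaled : HomogeneousFamily p (λ l → u (k l) ⊠ ι (w l))
  scaled l = subst (λ p′ → Homogeneous p′ _) (ℙ.+-identityʳ p)
                   (⊠-homogeneous (hu (k l)) (ι-homogeneous (w l)))

-- The rational weights of the recursion, transcribed from stepAB and stepCD:
-- they must be given explicitly, as Agda cannot recover them by unification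
-- through the arithmetic of ℚ.
sq-odd rp-even rp-odd sq-even : ℕ → ℕ → ℚ
sq-odd  h l = pw2 (2 ℕ.* l ℕ.+ 1) (2 ℕ.* h) ℚ.* s (2 ℕ.* l ∸ 1) h ℚ.+ q (2 ℕ.* l ∸ 1) h
rp-even h l = pw2 (2 ℕ.* l ℕ.+ 2) (2 ℕ.* h) ℚ.* r (2 ℕ.* l) h ℚ.+ p (2 ℕ.* l) h
rp-odd  h l = pw2 (2 ℕ.* l) (2 ℕ.* h) ℚ.* r (2 ℕ.* l ∸ 1) h ℚ.+ p (2 ℕ.* l ∸ 1) h
sq-even h l = pw2 (2 ℕ.* l ℕ.+ 1) (2 ℕ.* h) ℚ.* s (2 ℕ.* l) h ℚ.+ q (2 ℕ.* l) h

rpyz-odd : ℕ → ℚ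
rpyz-odd l = ⟦ 2 ℕ.^ (2 ℕ.* l) ⟧ ℚ.* (⟦ 2 ⟧ ℚ.* r (2 ℕ.* l ∸ 1) 0 ℚ.+ y (2 ℕ.* l ∸ 1) 0)
             ℚ.+ ⟦ 2 ⟧ ℚ.* p (2 ℕ.* l ∸ 1) 0 ℚ.+ z (2 ℕ.* l ∸ 1) 0

stepAB-homogeneous : ∀ n x → HomogeneousFamily 1ℙ (CD.cc x) → HomogeneousFamily 0ℙ (CD.dd x) →
  HomogeneousFamily 0ℙ (AB.aa (stepAB n x)) × HomogeneousFamily 1ℙ (AB.bb (stepAB n x))
stepAB-homogeneous n x hc hd = a-rational , b-irrational
  where
  a-rational : HomogeneousFamily 0ℙ (AB.aa (stepAB n x))
  a-rational h = ⊞-homogeneous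
    (⊠-homogeneous inv√3-homogeneous (Σ-scaled-homogeneous hc (suc h) n (_∸ 1) (sq-odd (suc h))))
    (Σ-scaled-homogeneous hd h n id (rp-even (suc h)))
  b-irrational : HomogeneousFamily 1ℙ (AB.bb (stepAB n x))
  b-irrational zero = ⊞-homogeneous
    (⊠-homogeneous (ι-homogeneous (+ 1 ℚ./ 3)) (Σ-scaled-homogeneous hc 1 n (_∸ 1) rpyz-odd))
    (⊠-homogeneous (⊠-homogeneous (ι-homogeneous ⟦ 2 ⟧) inv√3-homogeneous)
                   (Σ-scaled-homogeneous hd 0 n id (sq-even 0)))
  b-irrational (suc h) = ⊞-homogeneous
    (Σ-scaled-homogeneous hc (suc h) n (_∸ 1) (rp-odd (suc h)))
    (⊠-homogeneous inv√3-homogeneous (Σ-scaled-homogeneous hd h n id (sq-even (suc h))))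

stepCD-homogeneous : ∀ n x → HomogeneousFamily 0ℙ (AB.aa x) → HomogeneousFamily 1ℙ (AB.bb x) →
  HomogeneousFamily 1ℙ (CD.cc (stepCD n x)) × HomogeneousFamily 0ℙ (CD.dd (stepCD n x))
stepCD-homogeneous n x ha hb = c-irrational , d-rational
  where
  c-irrational : HomogeneousFamily 1ℙ (CD.cc (stepCD n x))
  c-irrational h = ⊞-homogeneous
    (⊠-homogeneous inv√3-homogeneous (Σ-scaled-homogeneous ha (suc h) n (_∸ 1) (sq-odd (suc h))))
    (Σ-scaled-homogeneous hb h (n ∸ 1) id (rp-even (suc h)))
  d-rational : HomogeneousFamily 0ℙ (CD.dd (stepCD n x))
  d-rational zero = ⊞-homogeneous
    (⊠-homogeneous (ι-homogeneous (+ 1 ℚ./ 3)) (Σ-scaled-homogeneous ha 1 n (_∸ 1) rpyz-odd))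
    (⊠-homogeneous (⊠-homogeneous (ι-homogeneous ⟦ 2 ⟧) inv√3-homogeneous)
                   (Σ-scaled-homogeneous hb 0 (n ∸ 1) id (sq-even 0)))
  d-rational (suc h) = ⊞-homogeneous
    (Σ-scaled-homogeneous ha (suc h) n (_∸ 1) (rp-odd (suc h)))
    (⊠-homogeneous inv√3-homogeneous (Σ-scaled-homogeneous hb (suc h) (n ∸ 1) id (sq-even (suc h))))

ab-homogeneous : ∀ n → HomogeneousFamily 0ℙ (a n) × HomogeneousFamily 1ℙ (b n)
cd-homogeneous : ∀ n → HomogeneousFamily 1ℙ (c n) × HomogeneousFamily 0ℙ (d n)

ab-homogeneous zero    = (λ _ → homogeneous refl) , (λ _ → homogeneous refl)
ab-homogeneous (suc n) = let hc , hd = cd-homogeneous n in stepAB-homogeneous n (cdSeq n) hc hd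

cd-homogeneous zero    = (λ _ → homogeneous refl) , d₀-rational
  where
  d₀-rational : HomogeneousFamily 0ℙ (d zero)
  d₀-rational zero    = homogeneous refl
  d₀-rational (suc k) = homogeneous refl
cd-homogeneous (suc n) = let ha , hb = ab-homogeneous (suc n) in stepCD-homogeneous (suc n) (abSeq (suc n)) ha hb

proposition2 : (n : ℕ) →
    ((j : ℕ) → j < n → InQ (a n j) × In√3Q (b n j) × In√3Q (c n j)) ×
    ((k : ℕ) → k ≤ n → InQ (d n k))
proposition2 n =
  let ha , hb = ab-homogeneous n
      hc , hd = cd-homogeneous n
  in (λ j _ → other-component≡0 (ha j) , other-component≡0 (hb j) , other-component≡0 (hc j)) ,
     (λ k _ → other-component≡0 (hd k))
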